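{- If a series–parallel graph $G$ contains $R_4$ as a substructure, then $G$ is not minimally $\frac12$-tough.
   Context: All graphs are finite and undirected; parallel edges allowed. For a graph $H$, $c(H)$ denotes its number of components. A set $S\subseteq V(G)$ is a cutset if $c(G-S)>1$. $G$ is $t$-tough if $|S|\ge t\cdot c(G-S)$ for every cutset $S$; $\tau(G)$ is the largest such $t$, with $\tau(K_n)=\infty$. $G$ is minimally $t$-tough if $\tau(G)=t$ and $\tau(G-e)<t$ for every edge $e$. A series–parallel graph $G(s,t)$ with terminals $s,t$ is either a single edge $st$, or is obtained from series–parallel graphs $G_1(s_1,t_1),\dots,G_k(s_k,t_k)$, $k\ge 2$, by a series join (identify $t_i$ with $s_{i+1}$, set $s=s_1$, $t=t_k$) or a parallel join (identify all $s_i$ into $s$ and all $t_i$ into $t$). The construction gives a rooted ordered tree $T_G$ (sp-tree): leaves are edges, internal nodes are series or parallel joins, with series and parallel nodes alternating along root-to-leaf paths. A substructure of $T_G$ rooted at a node $x$ consists of $x$ together with some of its children (consecutive ones if $x$ is a series node) and the complete subtrees below those children; only the root of a substructure may have further children not in it. $P_2$ is a series node with exactly two edge children. For $i\ge 2$, $R_i$ is a parallel node with $i$ children, each a $P_2$ (i.e. $i$ internally disjoint paths of length $2$ between two vertices). $G$ contains $R_4$ if $T_G$ has a substructure of this form with $i=4$. -}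

module Defs where

open import Data.Nat using (ℕ; zero; suc; _≤_; _<_)
open import Data.Fin using (Fin; toℕ)
open import Data.Fin.Subset using (Subset; _∉_; ∣_∣)
open import Data.Integer using (+_)
open import Data.Rational using (ℚ; _/_) renaming (_≤_ to _≤ℚ_; _<_ to _<ℚ_; _*_ to _*ℚ_)
open import Data.List using (List; []; _∷_; _++_; length; removeAt; replicate)
open import Data.List.Membership.Propositional using (_∈_)
open import Data.List.Relation.Unary.All using (All)
open import Data.List.Relation.Unary.Any using (Any)
open import Data.List.Relation.Binary.Sublist.Propositional using (_⊆_)
open import Data.Product using (_×_; _,_; proj₁; proj₂; ∃; ∃-syntax; Σ-syntax)
open import Data.Sum using (_⊎_)
open import Relation.Binary.PropositionalEquality using (_≡_; _≢_)
open import Relation.Nullary using (¬_)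

-- Multigraphs: vertex set {0,…,n-1} (as Fin n), edges a list of
-- unordered pairs (written as ordered pairs of naturals; direction is
-- ignored).  Parallel edges = repeated list entries, each a separate edge.

record Graph : Set where
  constructor mkGraph
  field
    n : ℕ
    E : List (ℕ × ℕ)
open Graph public

deleteEdge : (G : Graph) → Fin (length (E G)) → Graph
deleteEdge G i = mkGraph (n G) (removeAt (E G) i)

Adj : (G : Graph) → Subset (n G) → Fin (n G) → Fin (n G) → Set
Adj G S u v = u ∉ S × v ∉ S × ((toℕ u , toℕ v) ∈ E G ⊎ (toℕ v , toℕ u) ∈ E G)

data Reach (G : Graph) (S : Subset (n G)) : Fin (n G) → Fin (n G) → Set where
  here : ∀ {u} → u ∉ S → Reach G S u u
  step : ∀ {u v w} → Adj G S u v → Reach G S v w → Reach G S u w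

-- c(G - S) = k : there is a system of k representatives, one per component
NumComp : (G : Graph) → Subset (n G) → ℕ → Set
NumComp G S k =
  Σ[ r ∈ (Fin k → Fin (n G)) ] ( (∀ (i : Fin k) → r i ∉ S)
         × (∀ (i j : Fin k) → i ≢ j → ¬ Reach G S (r i) (r j))
         × (∀ (u : Fin (n G)) → u ∉ S → Σ[ i ∈ Fin k ] Reach G S u (r i)) )

Tough : Graph → ℚ → Set
Tough G t = ∀ (S : Subset (n G)) (k : ℕ) → NumComp G S k → 1 < k →
            t *ℚ (+ k / 1) ≤ℚ (+ ∣ S ∣ / 1)

-- τ(G) = t : t is the largest value for which G is t-tough
-- (for graphs with no cutset, e.g. K_n, no t satisfies this: τ = ∞)
HasToughness : Graph → ℚ → Set
HasToughness G t = Tough G t × (∀ t' → t <ℚ t' → ¬ Tough G t')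

MinimallyTough : Graph → ℚ → Set
MinimallyTough G t =
  HasToughness G t ×
  (∀ (e : Fin (length (E G))) → Σ[ t' ∈ ℚ ] (t' <ℚ t × HasToughness (deleteEdge G e) t'))

data Node : Set where
  leaf : Node
  ser  : List Node → Node
  par  : List Node → Node

data NotSer : Node → Set where
  leaf-ns : NotSer leaf
  par-ns  : ∀ {cs} → NotSer (par cs)

data NotPar : Node → Set where
  leaf-np : NotPar leaf
  ser-np  : ∀ {cs} → NotPar (ser cs)

data WF : Node → Set where
  wf-leaf : WF leaf
  wf-ser  : ∀ {cs} → 2 ≤ length cs → All WF cs → All NotSer cs → WF (ser cs)
  wf-par  : ∀ {cs} → 2 ≤ length cs → All WF cs → All NotPar cs → WF (par cs)

-- the graph of an sp-tree.  build T s t k: realise T between terminals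
-- s and t, using fresh vertex labels k, k+1, … ; returns edges and next
-- fresh label.
mutual
  build : Node → ℕ → ℕ → ℕ → List (ℕ × ℕ) × ℕ
  build leaf     s t k = ((s , t) ∷ []) , k
  build (ser cs) s t k = buildSer cs s t k
  build (par cs) s t k = buildPar cs s t k

  buildPar : List Node → ℕ → ℕ → ℕ → List (ℕ × ℕ) × ℕ
  buildPar []       s t k = [] , k
  buildPar (c ∷ cs) s t k =
    let r₁ = build c s t k
        r₂ = buildPar cs s t (proj₂ r₁)
    in (proj₁ r₁ ++ proj₁ r₂) , proj₂ r₂

  buildSer : List Node → ℕ → ℕ → ℕ → List (ℕ × ℕ) × ℕ
  buildSer []           s t k = [] , k
  buildSer (c ∷ [])     s t k = build c s t k
  buildSer (c ∷ d ∷ cs) s t k =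
    -- vertex k identifies t of child c with s of the next child
    let r₁ = build c s k (suc k)
        r₂ = buildSer (d ∷ cs) k t (proj₂ r₁)
    in (proj₁ r₁ ++ proj₁ r₂) , proj₂ r₂

spGraph : Node → Graph
spGraph T = mkGraph (proj₂ (build T 0 1 2)) (proj₁ (build T 0 1 2))

P₂ : Node
P₂ = ser (leaf ∷ leaf ∷ [])

data ContainsR4 : Node → Set where
  here  : ∀ {cs} → replicate 4 P₂ ⊆ cs → ContainsR4 (par cs)
  inSer : ∀ {cs} → Any ContainsR4 cs → ContainsR4 (ser cs)
  inPar : ∀ {cs} → Any ContainsR4 cs → ContainsR4 (par cs)

-- An R₄ substructure gives vertices s, t and a₀, …, a₃ whose only neighbours are s and t:
-- the aᵢ are fresh labels that no other part of the sp-tree uses. Deleting the edge e = s a₀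
-- keeps G ½-tough. Let S be a cutset of G − e with c components. If e does not join two of
-- them, S has the same components in G. Otherwise s, a₀ ∉ S lie in different components, and
-- S' = (S ∖ {a₀, …, a₃}) ∪ {s, t} isolates every aᵢ while keeping the c − 2 other components
-- apart, so c(G − S') ≥ c + 2. Moreover |S'| ≤ |S| + 1: if t ∉ S then a₁, a₂, a₃ ∈ S, as each
-- would otherwise join s to a₀ via t. Hence c + 2 ≤ 2|S'| ≤ 2|S| + 2.
module Submission where

open import Defs
open import Data.Rational using (½)
open import Relation.Nullary using (¬_)

open import Data.Nat using (ℕ; zero; suc; _+_; _*_; _≤_; _<_; z≤n; s≤s; _≤?_)
import Data.Nat.Properties as ℕP
open import Data.Nat.Coprimality using (1-coprimeTo) renaming (sym to coprime-sym)
open import Data.Integer as ℤ using (+_)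
import Data.Integer.Properties as ℤP
open import Data.Rational using (ℚ; mkℚ; _/_; toℚᵘ) renaming (_≤_ to _≤ℚ_; _*_ to _*ℚ_)
import Data.Rational.Properties as ℚP
import Data.Rational.Unnormalised as ℚᵘ
import Data.Rational.Unnormalised.Properties as ℚᵘP
open import Data.Fin as Fin using (Fin; zero; suc; toℕ; fromℕ<; splitAt; join; punchIn; punchOut)
import Data.Fin.Properties as FinP
open import Data.Fin.Subset using (Subset; _∈_; _∉_; _⊆_; ∣_∣; ⁅_⁆; _∪_; _-_; inside; outside)
open import Data.Fin.Subset.Properties
  using (_∈?_; drop-there; x∈⁅x⁆; x∈⁅y⁆⇒x≡y; ∣⁅x⁆∣≡1; ∣p∣≤∣x∷p∣; p⊆q⇒∣p∣≤∣q∣; x∈p∪q⁺; x∈p∪q⁻;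
         p─q⊆p; ∣p─q∣≤∣p∣; x∈p∧x≢y⇒x∈p-y; x∈p⇒∣p-x∣<∣p∣)
open import Data.Vec using ([]; _∷_)
import Data.Vec.Functional as Vector
open import Data.List as List using (List; []; _∷_; _++_; length; removeAt; replicate)
open import Data.List.Relation.Unary.All as All using (All; []; _∷_)
import Data.List.Relation.Unary.All.Properties as AllP
open import Data.List.Relation.Unary.Any using (Any; here; there; index)
open import Data.List.Relation.Unary.Any.Properties using (lookup-index)
open import Data.List.Membership.Propositional using () renaming (_∈_ to _∈ₗ_)
open import Data.List.Membership.Propositional.Properties using (∈-++⁺ˡ; ∈-++⁺ʳ)
open import Data.List.Relation.Binary.Sublist.Heterogeneous using (_∷ʳ_; _∷_)
open import Data.List.Relation.Binary.Sublist.Propositional using () renaming (_⊆_ to _⊑_)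
open import Data.Product as Product using (∃; ∃₂; _×_; _,_; -,_; proj₁; proj₂)
open import Data.Product.Properties using (,-injective)
open import Data.Sum as Sum using (_⊎_; inj₁; inj₂; [_,_])
open import Data.Empty using (⊥-elim)
open import Function using (_∘_; id; _⇔_; mk⇔; Equivalence)
open import Function.Definitions using (Injective)
open import Relation.Binary.Definitions using (Decidable)
open import Relation.Nullary using (Dec; yes; no; ¬?)
open import Relation.Nullary.Decidable using (decidable-stable; ¬¬-excluded-middle; _×-dec_; _⊎-dec_)
open import Relation.Binary.PropositionalEquality hiding ([_])

-- Toughness ½ over the naturals

n/1≡mkℚ : ∀ a → + a / 1 ≡ mkℚ (+ a) 0 (coprime-sym (1-coprimeTo a))
n/1≡mkℚ a = ℚP.normalize-coprime (coprime-sym (1-coprimeTo a))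

½*a≤b⇔a≤2*b : ∀ a b → (½ *ℚ (+ a / 1) ≤ℚ + b / 1) ⇔ (a ≤ 2 * b)
-- With + a / 1 in normal form toℚᵘ computes, and the claim becomes (1 · a) · 1 ≤ b · 2 in ℤ.
½*a≤b⇔a≤2*b a b rewrite n/1≡mkℚ a | n/1≡mkℚ b = mk⇔ to from
  where
  A B : ℚ
  A = mkℚ (+ a) 0 (coprime-sym (1-coprimeTo a))
  B = mkℚ (+ b) 0 (coprime-sym (1-coprimeTo b))
  ½A≃ : toℚᵘ (½ *ℚ A) ℚᵘ.≃ toℚᵘ ½ ℚᵘ.* toℚᵘ A
  ½A≃ = ℚP.toℚᵘ-homo-* ½ A
  lhs : (+ 1 ℤ.* + a) ℤ.* + 1 ≡ + a
  lhs = trans (ℤP.*-identityʳ _) (ℤP.*-identityˡ _)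
  rhs : + b ℤ.* + 2 ≡ + (2 * b)
  rhs = trans (sym (ℤP.pos-* b 2)) (cong +_ (ℕP.*-comm b 2))
  to : ½ *ℚ A ≤ℚ B → a ≤ 2 * b
  to h with ℚᵘP.≤-respˡ-≃ ½A≃ (ℚP.toℚᵘ-mono-≤ h)
  ... | ℚᵘ.*≤* cross = ℤP.drop‿+≤+ (subst₂ ℤ._≤_ lhs rhs cross)
  from : a ≤ 2 * b → ½ *ℚ A ≤ℚ B
  from h = ℚP.toℚᵘ-cancel-≤ (ℚᵘP.≤-respˡ-≃ (ℚᵘP.≃-sym ½A≃)
    (ℚᵘ.*≤* (subst₂ ℤ._≤_ (sym lhs) (sym rhs) (ℤ.+≤+ h))))

½-tough-intro : ∀ {G} → (∀ S m → NumComp G S (2 + m) → 2 + m ≤ 2 * ∣ S ∣) → Tough G ½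
½-tough-intro bound S (suc (suc m)) c _ = Equivalence.from (½*a≤b⇔a≤2*b (2 + m) ∣ S ∣) (bound S m c)
½-tough-intro bound S zero          c ()
½-tough-intro bound S (suc zero)    c (s≤s ())

½-tough-elim : ∀ {G S k} → Tough G ½ → NumComp G S k → 2 ≤ k → k ≤ 2 * ∣ S ∣
½-tough-elim {S = S} {k} T c 2≤k = Equivalence.to (½*a≤b⇔a≤2*b k ∣ S ∣) (T S k c 2≤k)

toughness-kept⇒¬minimallyTough : ∀ {G t} e → (Tough G t → Tough (deleteEdge G e) t) → ¬ MinimallyTough G t
toughness-kept⇒¬minimallyTough {t = t} e kept ((T , _) , critical) with critical e
... | _ , t'<t , (_ , nothing-tougher) = nothing-tougher t t'<t (kept T)

Edge : (G : Graph) → Fin (n G) → Fin (n G) → Set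
Edge G u v = (toℕ u , toℕ v) ∈ₗ E G

Linked : (G : Graph) → Fin (n G) → Fin (n G) → Set
Linked G u v = Edge G u v ⊎ Edge G v u

module _ {G : Graph} {S : Subset (n G)} where

  adj-sym : ∀ {u v} → Adj G S u v → Adj G S v u
  adj-sym (u∉S , v∉S , uv) = v∉S , u∉S , Sum.swap uv

  adj⇒reach : ∀ {u v} → Adj G S u v → Reach G S u v
  adj⇒reach adj = step adj (here (proj₁ (proj₂ adj)))

  reach-trans : ∀ {u v w} → Reach G S u v → Reach G S v w → Reach G S u w
  reach-trans (here _)     q = q
  reach-trans (step adj p) q = step adj (reach-trans p q)

  reach-target∉ : ∀ {u v} → Reach G S u v → v ∉ S
  reach-target∉ (here v∉S) = v∉S
  reach-target∉ (step _ p) = reach-target∉ p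

  reach-sym : ∀ {u v} → Reach G S u v → Reach G S v u
  reach-sym (here u∉S)   = here u∉S
  reach-sym (step adj p) = reach-trans (reach-sym p) (adj⇒reach (adj-sym adj))

-- Stated for graphs on a common vertex set, so that it applies to G and deleteEdge G e alike.
module _ {N : ℕ} {E₁ E₂ : List (ℕ × ℕ)} {S₁ S₂ : Subset N} where

  reach-map : (∀ {u v} → Adj (mkGraph N E₁) S₁ u v → Reach (mkGraph N E₂) S₂ u v) →
              ∀ {x y} → y ∉ S₂ → Reach (mkGraph N E₁) S₁ x y → Reach (mkGraph N E₂) S₂ x y
  reach-map f y∉S₂ (here _)     = here y∉S₂
  reach-map f y∉S₂ (step adj p) = reach-trans (f adj) (reach-map f y∉S₂ p)

Separated : (G : Graph) → Subset (n G) → ∀ {m} → (Fin m → Fin (n G)) → Set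
Separated G S f = (∀ i → f i ∉ S) × (∀ i j → Reach G S (f i) (f j) → i ≡ j)

Covering : (G : Graph) → Subset (n G) → ∀ {m} → (Fin m → Fin (n G)) → Set
Covering G S f = ∀ u → u ∉ S → ∃ λ i → Reach G S u (f i)

module _ {G : Graph} {S : Subset (n G)} where

  numComp⇒separated-covering : ∀ {k} → NumComp G S k → ∃ λ r → Separated G S r × Covering G S r
  numComp⇒separated-covering (r , r∉S , r-apart , r-cover) =
    r , (r∉S , λ i j p → decidable-stable (i Fin.≟ j) (λ i≢j → r-apart i j i≢j p)) , r-cover

  separated-covering⇒numComp : ∀ {m} {f : Fin m → Fin (n G)} → Separated G S f → Covering G S f → NumComp G S m
  separated-covering⇒numComp {f = f} (f∉S , f-sep) f-cover =
    f , f∉S , (λ i j i≢j p → i≢j (f-sep i j p)) , f-cover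

  separated⇒≤ : ∀ {m} {f : Fin m → Fin (n G)} → Separated G S f → m ≤ n G
  separated⇒≤ {f = f} (f∉S , f-sep) =
    FinP.injective⇒≤ λ {i} {j} fi≡fj → f-sep i j (subst (Reach G S (f i)) fi≡fj (here (f∉S i)))

  separated-∷ : ∀ {m u} {f : Fin m → Fin (n G)} → u ∉ S → (∀ i → ¬ Reach G S u (f i)) →
                Separated G S f → Separated G S (u Vector.∷ f)
  separated-∷ {u = u} {f} u∉S u↮f (f∉S , f-sep) = uf∉S , uf-sep
    where
    uf∉S : ∀ i → (u Vector.∷ f) i ∉ S
    uf∉S zero    = u∉S
    uf∉S (suc i) = f∉S i
    uf-sep : ∀ i j → Reach G S ((u Vector.∷ f) i) ((u Vector.∷ f) j) → i ≡ j
    uf-sep zero    zero    _ = refl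
    uf-sep zero    (suc j) p = ⊥-elim (u↮f j p)
    uf-sep (suc i) zero    p = ⊥-elim (u↮f i (reach-sym p))
    uf-sep (suc i) (suc j) p = cong suc (f-sep i j p)

  separated-++ : ∀ {k m} {f : Fin k → Fin (n G)} {g : Fin m → Fin (n G)} →
                 Separated G S f → Separated G S g → (∀ i j → ¬ Reach G S (f i) (g j)) →
                 Separated G S (f Vector.++ g)
  separated-++ {k} {m} {f} {g} (f∉S , f-sep) (g∉S , g-sep) f↮g =
    (λ i → ∉S (splitAt k i)) , λ i j p → splitAt-injective (sep (splitAt k i) (splitAt k j) p)
    where
    ∉S : ∀ x → [ f , g ] x ∉ S
    ∉S (inj₁ i) = f∉S i
    ∉S (inj₂ j) = g∉S j
    sep : ∀ x y → Reach G S ([ f , g ] x) ([ f , g ] y) → x ≡ y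
    sep (inj₁ i) (inj₁ j) p = cong inj₁ (f-sep i j p)
    sep (inj₁ i) (inj₂ j) p = ⊥-elim (f↮g i j p)
    sep (inj₂ i) (inj₁ j) p = ⊥-elim (f↮g j i (reach-sym p))
    sep (inj₂ i) (inj₂ j) p = cong inj₂ (g-sep i j p)
    splitAt-injective : ∀ {i j} → splitAt k i ≡ splitAt k j → i ≡ j
    splitAt-injective {i} {j} eq = begin
      i                      ≡⟨ FinP.join-splitAt k m i ⟨
      join k m (splitAt k i) ≡⟨ cong (join k m) eq ⟩
      join k m (splitAt k j) ≡⟨ FinP.join-splitAt k m j ⟩
      j                      ∎
      where open ≡-Reasoning

  module _ (reach? : Decidable (Reach G S)) where

    covering-or-extensible : ∀ {m} (f : Fin m → Fin (n G)) →
                             Covering G S f ⊎ ∃ λ u → u ∉ S × ∀ i → ¬ Reach G S u (f i)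
    covering-or-extensible f
      with FinP.any? (λ u → ¬? (u ∈? S) ×-dec FinP.all? (λ i → ¬? (reach? u (f i))))
    ... | yes extension = inj₂ extension
    ... | no ¬extension = inj₁ cover
      where
      cover : Covering G S f
      cover u u∉S with FinP.any? (λ i → reach? u (f i))
      ... | yes hit = hit
      ... | no ¬hit = ⊥-elim (¬extension (u , u∉S , λ i p → ¬hit (i , p)))

    -- The fuel suffices since a separated family has at most n G members.
    separated⇒numComp : ∀ fuel {m} {f : Fin m → Fin (n G)} → n G ≤ fuel + m → Separated G S f →
                        ∃ λ K → m ≤ K × NumComp G S K
    separated⇒numComp fuel {m} {f} n≤fuel+m f-sep =
      [ complete , extend fuel n≤fuel+m ] (covering-or-extensible f)
      where
      complete : Covering G S f → ∃ λ K → m ≤ K × NumComp G S K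
      complete f-cover = m , ℕP.≤-refl , separated-covering⇒numComp f-sep f-cover
      extend : ∀ fuel → n G ≤ fuel + m → (∃ λ u → u ∉ S × ∀ i → ¬ Reach G S u (f i)) →
               ∃ λ K → m ≤ K × NumComp G S K
      extend zero n≤m (u , u∉S , u↮f) =
        ⊥-elim (ℕP.n≮n m (ℕP.≤-trans (separated⇒≤ (separated-∷ u∉S u↮f f-sep)) n≤m))
      extend (suc b) n≤1+b+m (u , u∉S , u↮f) =
        let K , 1+m≤K , c = separated⇒numComp b n≤b+1+m (separated-∷ u∉S u↮f f-sep)
        in  K , ℕP.≤-trans (ℕP.n≤1+n m) 1+m≤K , c
        where
        n≤b+1+m : n G ≤ b + suc m
        n≤b+1+m = ℕP.≤-trans n≤1+b+m (ℕP.≤-reflexive (sym (ℕP.+-suc b m)))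

¬¬-∀-Fin : ∀ {n} {P : Fin n → Set} → (∀ i → ¬ ¬ P i) → ¬ ¬ (∀ i → P i)
¬¬-∀-Fin {zero}  _    k = k λ ()
¬¬-∀-Fin {suc n} ¬¬P k = ¬¬P zero λ p₀ → ¬¬-∀-Fin (¬¬P ∘ suc) λ ps → k λ { zero → p₀ ; (suc i) → ps i }

¬¬-reach? : ∀ {G S} → ¬ ¬ Decidable (Reach G S)
¬¬-reach? = ¬¬-∀-Fin λ _ → ¬¬-∀-Fin λ _ → ¬¬-excluded-middle

-- Counting components needs Reach to be decidable, which holds only under ¬¬;
-- the conclusion is a decidable inequality, so the ¬¬ can be discharged.
½-tough⇒separated-bound : ∀ {G S m} {f : Fin m → Fin (n G)} → Tough G ½ → Separated G S f → 2 ≤ m →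
                          m ≤ 2 * ∣ S ∣
½-tough⇒separated-bound {G} {S} {m} T f-sep 2≤m = decidable-stable (m ≤? 2 * ∣ S ∣) λ m≰2∣S∣ →
  ¬¬-reach? λ reach? →
    let K , m≤K , c = separated⇒numComp reach? (n G) (ℕP.m≤m+n (n G) m) f-sep
    in  m≰2∣S∣ (ℕP.≤-trans m≤K (½-tough-elim T c (ℕP.≤-trans 2≤m m≤K)))

x∉p-x : ∀ {n} (p : Subset n) x → x ∉ p - x
x∉p-x (_ ∷ p) zero    ()
x∉p-x (_ ∷ p) (suc x) x∈ = x∉p-x p x (drop-there x∈)

∣p∪q∣≤∣p∣+∣q∣ : ∀ {n} (p q : Subset n) → ∣ p ∪ q ∣ ≤ ∣ p ∣ + ∣ q ∣
∣p∪q∣≤∣p∣+∣q∣ []            []            = z≤n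
∣p∪q∣≤∣p∣+∣q∣ (inside  ∷ p) (y       ∷ q) =
  s≤s (ℕP.≤-trans (∣p∪q∣≤∣p∣+∣q∣ p q) (ℕP.+-monoʳ-≤ ∣ p ∣ (∣p∣≤∣x∷p∣ y q)))
∣p∪q∣≤∣p∣+∣q∣ (outside ∷ p) (inside  ∷ q) =
  ℕP.≤-trans (s≤s (∣p∪q∣≤∣p∣+∣q∣ p q)) (ℕP.≤-reflexive (sym (ℕP.+-suc ∣ p ∣ ∣ q ∣)))
∣p∪q∣≤∣p∣+∣q∣ (outside ∷ p) (outside ∷ q) = ∣p∪q∣≤∣p∣+∣q∣ p q

∣⁅x⁆∪p∣≤1+∣p∣ : ∀ {n} x (p : Subset n) → ∣ ⁅ x ⁆ ∪ p ∣ ≤ suc ∣ p ∣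
∣⁅x⁆∪p∣≤1+∣p∣ x p = subst (λ c → ∣ ⁅ x ⁆ ∪ p ∣ ≤ c + ∣ p ∣) (∣⁅x⁆∣≡1 x) (∣p∪q∣≤∣p∣+∣q∣ ⁅ x ⁆ p)

infixl 5 _─ᶠ_

_─ᶠ_ : ∀ {m n} → Subset n → (Fin m → Fin n) → Subset n
_─ᶠ_ {zero}  p f = p
_─ᶠ_ {suc m} p f = p ─ᶠ (f ∘ suc) - f zero

p─ᶠf⊆p : ∀ {m n} (p : Subset n) (f : Fin m → Fin n) → p ─ᶠ f ⊆ p
p─ᶠf⊆p {zero}  p f x∈ = x∈
p─ᶠf⊆p {suc m} p f x∈ = p─ᶠf⊆p p (f ∘ suc) (p─q⊆p _ _ x∈)

fi∉p─ᶠf : ∀ {m n} (p : Subset n) (f : Fin m → Fin n) i → f i ∉ p ─ᶠ f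
fi∉p─ᶠf p f zero    = x∉p-x _ (f zero)
fi∉p─ᶠf p f (suc i) = fi∉p─ᶠf p (f ∘ suc) i ∘ p─q⊆p _ _

x∈p─ᶠf : ∀ {m n} {p : Subset n} {f : Fin m → Fin n} {x} → x ∈ p → (∀ i → x ≢ f i) → x ∈ p ─ᶠ f
x∈p─ᶠf {zero}  x∈p _   = x∈p
x∈p─ᶠf {suc m} x∈p x≢f = x∈p∧x≢y⇒x∈p-y (x∈p─ᶠf x∈p (x≢f ∘ suc)) (x≢f zero)

m+∣p─ᶠf∣≤∣p∣ : ∀ {m n} (p : Subset n) {f : Fin m → Fin n} → Injective _≡_ _≡_ f → (∀ i → f i ∈ p) →
               m + ∣ p ─ᶠ f ∣ ≤ ∣ p ∣
m+∣p─ᶠf∣≤∣p∣ {zero}  p f-inj f∈p = ℕP.≤-refl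
m+∣p─ᶠf∣≤∣p∣ {suc m} {n} p {f} f-inj f∈p = begin
  suc m + ∣ q - f zero ∣   ≡⟨ ℕP.+-suc m _ ⟨
  m + suc ∣ q - f zero ∣   ≤⟨ ℕP.+-monoʳ-≤ m (x∈p⇒∣p-x∣<∣p∣ f₀∈q) ⟩
  m + ∣ q ∣                ≤⟨ m+∣p─ᶠf∣≤∣p∣ p (FinP.suc-injective ∘ f-inj) (f∈p ∘ suc) ⟩
  ∣ p ∣                    ∎
  where
  open ℕP.≤-Reasoning
  q : Subset n
  q = p ─ᶠ (f ∘ suc)
  f₀∈q : f zero ∈ q
  f₀∈q = x∈p─ᶠf {f = f ∘ suc} (f∈p zero) (λ i → FinP.0≢1+n ∘ f-inj)

-- Deleting an edge of four parallel P₂'s preserves ½-toughness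

∈-removeAt⁺ : ∀ {A : Set} {x : A} (xs : List A) i → x ∈ₗ xs → x ≢ List.lookup xs i → x ∈ₗ removeAt xs i
∈-removeAt⁺ (y ∷ ys) zero    (here x≡y)  x≢y = ⊥-elim (x≢y x≡y)
∈-removeAt⁺ (y ∷ ys) zero    (there x∈)  _   = x∈
∈-removeAt⁺ (y ∷ ys) (suc i) (here x≡y)  _   = here x≡y
∈-removeAt⁺ (y ∷ ys) (suc i) (there x∈)  x≢y = there (∈-removeAt⁺ ys i x∈ x≢y)

module _ {m} {i j : Fin (suc (suc m))} (i≢j : i ≢ j) where

  punchIn₂ : Fin m → Fin (suc (suc m))
  punchIn₂ = punchIn i ∘ punchIn (punchOut i≢j)

  punchIn₂-injective : Injective _≡_ _≡_ punchIn₂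
  punchIn₂-injective = FinP.punchIn-injective (punchOut i≢j) _ _ ∘ FinP.punchIn-injective i _ _

  punchIn₂≢ˡ : ∀ l → punchIn₂ l ≢ i
  punchIn₂≢ˡ l = FinP.punchInᵢ≢i i _

  punchIn₂≢ʳ : ∀ l → punchIn₂ l ≢ j
  punchIn₂≢ʳ l eq = FinP.punchInᵢ≢i (punchOut i≢j) l
    (FinP.punchIn-injective i _ _ (trans eq (sym (FinP.punchIn-punchOut i≢j))))

record ParallelP₂s (G : Graph) (k : ℕ) : Set where
  field
    s t            : Fin (n G)
    mid            : Fin k → Fin (n G)
    mid-injective  : Injective _≡_ _≡_ mid
    mid≢s          : ∀ i → mid i ≢ s
    mid≢t          : ∀ i → mid i ≢ t
    s—mid          : ∀ i → Edge G s (mid i)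
    mid—t          : ∀ i → Edge G (mid i) t
    mid-neighbours : ∀ i {w} → Linked G (mid i) w → w ≡ s ⊎ w ≡ t

module DeleteFirstMiddleEdge {G : Graph} (P : ParallelP₂s G 4) where
  open ParallelP₂s P

  a₀ : Fin (n G)
  a₀ = mid zero

  e : Fin (length (E G))
  e = index (s—mid zero)

  G' : Graph
  G' = deleteEdge G e

  Deleted : Fin (n G) → Fin (n G) → Set
  Deleted u v = (u ≡ s × v ≡ a₀) ⊎ (v ≡ s × u ≡ a₀)

  kept : ∀ {u v} → Edge G u v → ¬ (u ≡ s × v ≡ a₀) → Edge G' u v
  kept {u} {v} uv ¬del = ∈-removeAt⁺ (E G) e uv λ uv≡e →
    let u≡s , v≡a₀ = ,-injective (trans uv≡e (sym (lookup-index (s—mid zero))))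
    in  ¬del (FinP.toℕ-injective u≡s , FinP.toℕ-injective v≡a₀)

  s—mid' : ∀ i → i ≢ zero → Edge G' s (mid i)
  s—mid' i i≢0 = kept (s—mid i) (i≢0 ∘ mid-injective ∘ proj₂)

  mid—t' : ∀ i → Edge G' (mid i) t
  mid—t' i = kept (mid—t i) (mid≢s i ∘ proj₁)

  edge-split : ∀ {u v} → Edge G u v → Edge G' u v ⊎ (u ≡ s × v ≡ a₀)
  edge-split {u} {v} uv with u Fin.≟ s ×-dec v Fin.≟ a₀
  ... | yes del = inj₂ del
  ... | no ¬del = inj₁ (kept uv ¬del)

  adj-split : ∀ {S u v} → Adj G S u v → Adj G' S u v ⊎ Deleted u v
  adj-split (u∉S , v∉S , inj₁ uv) = Sum.map (λ uv' → u∉S , v∉S , inj₁ uv') inj₁ (edge-split uv)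
  adj-split (u∉S , v∉S , inj₂ vu) = Sum.map (λ vu' → u∉S , v∉S , inj₂ vu') inj₂ (edge-split vu)

  reach-G⇒G' : ∀ {S x y} → s ∈ S ⊎ a₀ ∈ S ⊎ Reach G' S s a₀ → Reach G S x y → Reach G' S x y
  reach-G⇒G' {S} bypass x⇝y = reach-map step' (reach-target∉ x⇝y) x⇝y
    where
    s⇝a₀ : s ∉ S → a₀ ∉ S → Reach G' S s a₀
    s⇝a₀ s∉S a₀∉S = [ ⊥-elim ∘ s∉S , [ ⊥-elim ∘ a₀∉S , id ] ] bypass
    step' : ∀ {u v} → Adj G S u v → Reach G' S u v
    step' adj@(u∉S , v∉S , _) with adj-split adj
    ... | inj₁ adj'                = adj⇒reach adj'
    ... | inj₂ (inj₁ (refl , refl)) = s⇝a₀ u∉S v∉S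
    ... | inj₂ (inj₂ (refl , refl)) = reach-sym (s⇝a₀ v∉S u∉S)

  separated-in-G : ∀ {S m} {r : Fin m → Fin (n G)} → s ∈ S ⊎ a₀ ∈ S ⊎ Reach G' S s a₀ →
                   Separated G' S r → Separated G S r
  separated-in-G bypass (r∉S , r-sep) = r∉S , λ i j → r-sep i j ∘ reach-G⇒G' bypass

  module Bridge (S : Subset (n G)) {m} {r : Fin (2 + m) → Fin (n G)}
                (r-sep : Separated G' S r) (r-cover : Covering G' S r)
                (s∉S : s ∉ S) (a₀∉S : a₀ ∉ S) (s↮a₀ : ¬ Reach G' S s a₀) where

    iₛ iₐ : Fin (2 + m)
    iₛ = proj₁ (r-cover s s∉S)
    iₐ = proj₁ (r-cover a₀ a₀∉S)

    iₛ≢iₐ : iₛ ≢ iₐ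
    iₛ≢iₐ iₛ≡iₐ = s↮a₀ (reach-trans (proj₂ (r-cover s s∉S))
      (reach-sym (subst (Reach G' S a₀ ∘ r) (sym iₛ≡iₐ) (proj₂ (r-cover a₀ a₀∉S)))))

    others : Fin m → Fin (n G)
    others = r ∘ punchIn₂ iₛ≢iₐ

    Attached : Fin (n G) → Set
    Attached x = Reach G' S x s ⊎ Reach G' S x a₀

    others-avoid : ∀ l {x} → x ∈ S ⊎ Attached x → others l ≢ x
    others-avoid l (inj₁ x∈S) refl = proj₁ r-sep _ x∈S
    others-avoid l (inj₂ (inj₁ x⇝s)) refl =
      punchIn₂≢ˡ iₛ≢iₐ l (proj₂ r-sep _ _ (reach-trans x⇝s (proj₂ (r-cover s s∉S))))
    others-avoid l (inj₂ (inj₂ x⇝a₀)) refl =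
      punchIn₂≢ʳ iₛ≢iₐ l (proj₂ r-sep _ _ (reach-trans x⇝a₀ (proj₂ (r-cover a₀ a₀∉S))))

    t-avoided : t ∈ S ⊎ Attached t
    t-avoided with t ∈? S
    ... | yes t∈S = inj₁ t∈S
    ... | no  t∉S = inj₂ (inj₂ (adj⇒reach (t∉S , a₀∉S , inj₂ (mid—t' zero))))

    mid-avoided : ∀ i → mid i ∈ S ⊎ Attached (mid i)
    mid-avoided i with mid i ∈? S
    ... | yes mᵢ∈S = inj₁ mᵢ∈S
    mid-avoided zero    | no a₀∉S' = inj₂ (inj₂ (here a₀∉S'))
    mid-avoided (suc i) | no mᵢ∉S  = inj₂ (inj₁ (adj⇒reach (mᵢ∉S , s∉S , inj₂ (s—mid' (suc i) λ ()))))

    -- Otherwise s, mid (suc i), t, a₀ is a path in G' − S.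
    mid∈S : t ∉ S → ∀ i → mid (suc i) ∈ S
    mid∈S t∉S i with mid (suc i) ∈? S
    ... | yes mᵢ∈S = mᵢ∈S
    ... | no  mᵢ∉S = ⊥-elim (s↮a₀
      (step (s∉S , mᵢ∉S , inj₁ (s—mid' (suc i) λ ()))
      (step (mᵢ∉S , t∉S , inj₁ (mid—t' (suc i)))
      (adj⇒reach (t∉S , a₀∉S , inj₂ (mid—t' zero))))))

    S' : Subset (n G)
    S' = ⁅ s ⁆ ∪ ⁅ t ⁆ ∪ (S ─ᶠ mid)

    ∈S'⁻ : ∀ {x} → x ∈ S' → x ≡ s ⊎ x ≡ t ⊎ x ∈ S ─ᶠ mid
    ∈S'⁻ x∈S' = Sum.map (x∈⁅y⁆⇒x≡y s) (Sum.map₁ (x∈⁅y⁆⇒x≡y t) ∘ x∈p∪q⁻ _ _) (x∈p∪q⁻ _ _ x∈S')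

    terminal∈S' : ∀ {x} → x ≡ s ⊎ x ≡ t → x ∈ S'
    terminal∈S' (inj₁ refl) = x∈p∪q⁺ (inj₁ (x∈⁅x⁆ s))
    terminal∈S' (inj₂ refl) = x∈p∪q⁺ (inj₂ (x∈p∪q⁺ (inj₁ (x∈⁅x⁆ t))))

    mid∉S' : ∀ i → mid i ∉ S'
    mid∉S' i = [ mid≢s i , [ mid≢t i , fi∉p─ᶠf S mid i ] ] ∘ ∈S'⁻

    ∉S⇒∉S' : ∀ {x} → x ∉ S → x ≢ s → x ≢ t → x ∉ S'
    ∉S⇒∉S' x∉S x≢s x≢t = [ x≢s , [ x≢t , x∉S ∘ p─ᶠf⊆p S mid ] ] ∘ ∈S'⁻

    ∉S'⇒∉S : ∀ {x} → x ∉ S' → (∀ i → x ≢ mid i) → x ∉ S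
    ∉S'⇒∉S x∉S' x≢mid x∈S = x∉S' (x∈p∪q⁺ (inj₂ (x∈p∪q⁺ (inj₂ (x∈p─ᶠf x∈S x≢mid)))))

    mid-isolated : ∀ i {u} → ¬ Adj G S' (mid i) u
    mid-isolated i (_ , u∉S' , mᵢu) = u∉S' (terminal∈S' (mid-neighbours i mᵢu))

    reach-from-mid : ∀ i {u} → Reach G S' (mid i) u → u ≡ mid i
    reach-from-mid i (here _)     = refl
    reach-from-mid i (step adj _) = ⊥-elim (mid-isolated i adj)

    adj-S'⇒S : ∀ {u v} → Adj G S' u v → Adj G' S u v
    adj-S'⇒S adj@(u∉S' , v∉S' , _) with adj-split adj
    ... | inj₁ (_ , _ , uv') = ∉S'⇒∉S u∉S' u≢mid , ∉S'⇒∉S v∉S' v≢mid , uv'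
      where
      u≢mid : ∀ i → _ ≢ mid i
      u≢mid i refl = mid-isolated i adj
      v≢mid : ∀ i → _ ≢ mid i
      v≢mid i refl = mid-isolated i (adj-sym adj)
    ... | inj₂ (inj₁ (refl , _)) = ⊥-elim (u∉S' (terminal∈S' (inj₁ refl)))
    ... | inj₂ (inj₂ (refl , _)) = ⊥-elim (v∉S' (terminal∈S' (inj₁ refl)))

    mid-separated : Separated G S' mid
    mid-separated = mid∉S' , λ i j mᵢ⇝mⱼ → mid-injective (sym (reach-from-mid i mᵢ⇝mⱼ))

    others-separated : Separated G S' others
    others-separated = others∉S' , λ l l' p →
      punchIn₂-injective iₛ≢iₐ (proj₂ r-sep _ _ (reach-map (adj⇒reach ∘ adj-S'⇒S) (proj₁ r-sep _) p))
      where
      others∉S' : ∀ l → others l ∉ S'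
      others∉S' l = ∉S⇒∉S' (proj₁ r-sep _) (others-avoid l (inj₂ (inj₁ (here s∉S)))) (others-avoid l t-avoided)

    components : Separated G S' (mid Vector.++ others)
    components = separated-++ mid-separated others-separated
      λ i l p → others-avoid l (mid-avoided i) (reach-from-mid i p)

    ∣S'∣≤1+∣S∣ : ∣ S' ∣ ≤ suc ∣ S ∣
    ∣S'∣≤1+∣S∣ with t ∈? S
    ... | yes t∈S = begin
      ∣ S' ∣          ≤⟨ p⊆q⇒∣p∣≤∣q∣ S'⊆⁅s⁆∪S ⟩
      ∣ ⁅ s ⁆ ∪ S ∣   ≤⟨ ∣⁅x⁆∪p∣≤1+∣p∣ s S ⟩
      suc ∣ S ∣       ∎
      where
      open ℕP.≤-Reasoning
      S'⊆⁅s⁆∪S : S' ⊆ ⁅ s ⁆ ∪ S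
      S'⊆⁅s⁆∪S x∈S' with ∈S'⁻ x∈S'
      ... | inj₁ refl        = x∈p∪q⁺ (inj₁ (x∈⁅x⁆ s))
      ... | inj₂ (inj₁ refl) = x∈p∪q⁺ (inj₂ t∈S)
      ... | inj₂ (inj₂ x∈)   = x∈p∪q⁺ (inj₂ (p─ᶠf⊆p S mid x∈))
    ... | no t∉S = begin
      ∣ S' ∣                        ≤⟨ ∣⁅x⁆∪p∣≤1+∣p∣ s _ ⟩
      suc ∣ ⁅ t ⁆ ∪ (S ─ᶠ mid) ∣    ≤⟨ s≤s (∣⁅x⁆∪p∣≤1+∣p∣ t _) ⟩
      2 + ∣ S ─ᶠ mid ∣              ≤⟨ ℕP.+-monoʳ-≤ 2 (∣p─q∣≤∣p∣ (S ─ᶠ (mid ∘ suc)) ⁅ a₀ ⁆) ⟩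
      2 + ∣ S ─ᶠ (mid ∘ suc) ∣      ≤⟨ ℕP.n≤1+n _ ⟩
      3 + ∣ S ─ᶠ (mid ∘ suc) ∣      ≤⟨ m+∣p─ᶠf∣≤∣p∣ S (FinP.suc-injective ∘ mid-injective) (mid∈S t∉S) ⟩
      ∣ S ∣                         ≤⟨ ℕP.n≤1+n _ ⟩
      suc ∣ S ∣                     ∎
      where open ℕP.≤-Reasoning

    bound : Tough G ½ → 2 + m ≤ 2 * ∣ S ∣
    bound T = ℕP.+-cancelˡ-≤ 2 _ _ (begin
      4 + m           ≤⟨ ½-tough⇒separated-bound T components (s≤s (s≤s z≤n)) ⟩
      2 * ∣ S' ∣      ≤⟨ ℕP.*-monoʳ-≤ 2 ∣S'∣≤1+∣S∣ ⟩
      2 * suc ∣ S ∣   ≡⟨ ℕP.*-suc 2 ∣ S ∣ ⟩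
      2 + 2 * ∣ S ∣   ∎)
      where open ℕP.≤-Reasoning

  ½-tough-G' : Tough G ½ → Tough G' ½
  ½-tough-G' T = ½-tough-intro λ S m c →
    let r , r-sep , r-cover = numComp⇒separated-covering c
    in  decidable-stable (2 + m ≤? 2 * ∣ S ∣) λ ≰ → ¬¬-excluded-middle (≰ ∘ bound S r-sep r-cover)
    where
    bound : ∀ S {m} {r : Fin (2 + m) → Fin (n G)} → Separated G' S r → Covering G' S r →
            Dec (Reach G' S s a₀) → 2 + m ≤ 2 * ∣ S ∣
    bound S r-sep r-cover s⇝a₀? with s ∈? S ⊎-dec a₀ ∈? S ⊎-dec s⇝a₀?
    ... | yes bypass = ½-tough⇒separated-bound T (separated-in-G bypass r-sep) (ℕP.m≤m+n 2 _)
    ... | no ¬bypass = Bridge.bound S r-sep r-cover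
                         (¬bypass ∘ inj₁) (¬bypass ∘ inj₂ ∘ inj₁) (¬bypass ∘ inj₂ ∘ inj₂) T

parallelP₂s⇒¬minimallyTough : ∀ {G} → ParallelP₂s G 4 → ¬ MinimallyTough G ½
parallelP₂s⇒¬minimallyTough P = toughness-kept⇒¬minimallyTough e ½-tough-G'
  where open DeleteFirstMiddleEdge P

-- R₄ in the graph of an sp-tree

Edges : Set
Edges = List (ℕ × ℕ)

BothEnds : (ℕ → Set) → ℕ × ℕ → Set
BothEnds P (x , y) = P x × P y

InRange : ℕ → ℕ → ℕ → ℕ → ℕ → Set
InRange s t lo hi x = x ≡ s ⊎ x ≡ t ⊎ (lo ≤ x × x < hi)

Outside : ℕ → ℕ → ℕ → Set
Outside lo hi x = x < lo ⊎ hi ≤ x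

Spans : ℕ → ℕ → ℕ → ℕ → Edges → Set
Spans s t lo hi = All (BothEnds (InRange s t lo hi))

Spanned : ℕ → ℕ → ℕ → Edges × ℕ → Set
Spanned s t k (L , k') = k ≤ k' × Spans s t k k' L

lo∈InRange : ∀ {s t lo hi} → lo < hi → InRange s t lo hi lo
lo∈InRange lo<hi = inj₂ (inj₂ (ℕP.≤-refl , lo<hi))

spans-widen : ∀ {s t lo hi s' t' lo' hi' L} → InRange s t lo hi s' → InRange s t lo hi t' →
              lo ≤ lo' → hi' ≤ hi → Spans s' t' lo' hi' L → Spans s t lo hi L
spans-widen {s} {t} {lo} {hi} {s'} {t'} {lo'} {hi'} s'∈ t'∈ lo≤lo' hi'≤hi = All.map (Product.map widen widen)
  where
  widen : ∀ {x} → InRange s' t' lo' hi' x → InRange s t lo hi x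
  widen (inj₁ refl)                = s'∈
  widen (inj₂ (inj₁ refl))         = t'∈
  widen (inj₂ (inj₂ (lo'≤x , x<hi'))) = inj₂ (inj₂ (ℕP.≤-trans lo≤lo' lo'≤x , ℕP.<-≤-trans x<hi' hi'≤hi))

series-spanned : ∀ {s t k k₁ k₂ L₁ L₂} → Spanned s k (suc k) (L₁ , k₁) → Spanned k t k₁ (L₂ , k₂) →
                 Spanned s t k (L₁ ++ L₂ , k₂)
series-spanned {k = k} {k₂ = k₂} (k<k₁ , L₁) (k₁≤k₂ , L₂) = ℕP.<⇒≤ k<k₂ , AllP.++⁺
  (spans-widen (inj₁ refl) (lo∈InRange k<k₂) (ℕP.n≤1+n k) k₁≤k₂ L₁)
  (spans-widen (lo∈InRange k<k₂) (inj₂ (inj₁ refl)) (ℕP.<⇒≤ k<k₁) ℕP.≤-refl L₂)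
  where
  k<k₂ : k < k₂
  k<k₂ = ℕP.<-≤-trans k<k₁ k₁≤k₂

parallel-spanned : ∀ {s t k k₁ k₂ L₁ L₂} → Spanned s t k (L₁ , k₁) → Spanned s t k₁ (L₂ , k₂) →
                   Spanned s t k (L₁ ++ L₂ , k₂)
parallel-spanned (k≤k₁ , L₁) (k₁≤k₂ , L₂) = ℕP.≤-trans k≤k₁ k₁≤k₂ , AllP.++⁺
  (spans-widen (inj₁ refl) (inj₂ (inj₁ refl)) ℕP.≤-refl k₁≤k₂ L₁)
  (spans-widen (inj₁ refl) (inj₂ (inj₁ refl)) k≤k₁ ℕP.≤-refl L₂)

mutual
  build-spanned : ∀ T s t k → Spanned s t k (build T s t k)
  build-spanned leaf     s t k = ℕP.≤-refl , (inj₁ refl , inj₂ (inj₁ refl)) ∷ []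
  build-spanned (ser cs) s t k = buildSer-spanned cs s t k
  build-spanned (par cs) s t k = buildPar-spanned cs s t k

  buildSer-spanned : ∀ cs s t k → Spanned s t k (buildSer cs s t k)
  buildSer-spanned []           s t k = ℕP.≤-refl , []
  buildSer-spanned (c ∷ [])     s t k = build-spanned c s t k
  buildSer-spanned (c ∷ d ∷ cs) s t k =
    series-spanned (build-spanned c s k (suc k)) (buildSer-spanned (d ∷ cs) k t (proj₂ (build c s k (suc k))))

  buildPar-spanned : ∀ cs s t k → Spanned s t k (buildPar cs s t k)
  buildPar-spanned []       s t k = ℕP.≤-refl , []
  buildPar-spanned (c ∷ cs) s t k =
    parallel-spanned (build-spanned c s t k) (buildPar-spanned cs s t (proj₂ (build c s t k)))

Confined : ℕ → ℕ → ℕ → ℕ × ℕ → Set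
Confined s t a (x , y) = (x ≡ a → y ≡ s ⊎ y ≡ t) × (y ≡ a → x ≡ s ⊎ x ≡ t)

record Pendant (s t : ℕ) (L : Edges) (a : ℕ) : Set where
  field
    a≢s      : a ≢ s
    a≢t      : a ≢ t
    s—a      : (s , a) ∈ₗ L
    a—t      : (a , t) ∈ₗ L
    confined : All (Confined s t a) L

module _ {s t a : ℕ} {L : Edges} where

  pendant-++ˡ : ∀ {L₁} → All (Confined s t a) L₁ → Pendant s t L a → Pendant s t (L₁ ++ L) a
  pendant-++ˡ {L₁} c₁ p = record
    { a≢s = a≢s ; a≢t = a≢t ; s—a = ∈-++⁺ʳ L₁ s—a ; a—t = ∈-++⁺ʳ L₁ a—t ; confined = AllP.++⁺ c₁ confined }
    where open Pendant p

  pendant-++ʳ : ∀ {L₂} → All (Confined s t a) L₂ → Pendant s t L a → Pendant s t (L ++ L₂) a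
  pendant-++ʳ c₂ p = record
    { a≢s = a≢s ; a≢t = a≢t ; s—a = ∈-++⁺ˡ s—a ; a—t = ∈-++⁺ˡ a—t ; confined = AllP.++⁺ confined c₂ }
    where open Pendant p

P₂-pendant : ∀ {s t k} → s < k → t < k → Pendant s t ((s , k) ∷ (k , t) ∷ []) k
P₂-pendant s<k t<k = record
  { a≢s = ℕP.>⇒≢ s<k ; a≢t = ℕP.>⇒≢ t<k ; s—a = here refl ; a—t = there (here refl)
  ; confined = (⊥-elim ∘ ℕP.<⇒≢ s<k , λ _ → inj₁ refl) ∷ ((λ _ → inj₂ refl) , ⊥-elim ∘ ℕP.<⇒≢ t<k) ∷ [] }

outside⇒confined : ∀ {s t lo hi a} → lo ≤ a → a < hi → ∀ {e} → BothEnds (Outside lo hi) e → Confined s t a e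
outside⇒confined {lo = lo} {hi} {a} lo≤a a<hi (x-out , y-out) = ⊥-elim ∘ avoids x-out , ⊥-elim ∘ avoids y-out
  where
  avoids : ∀ {x} → Outside lo hi x → x ≢ a
  avoids (inj₁ x<lo) refl = ℕP.n≮n a (ℕP.<-≤-trans x<lo lo≤a)
  avoids (inj₂ hi≤x) refl = ℕP.n≮n a (ℕP.<-≤-trans a<hi hi≤x)

spans⇒outside : ∀ {lo hi s' t' lo' hi' L} → s' < lo → t' < lo → hi' ≤ lo ⊎ hi ≤ lo' →
                Spans s' t' lo' hi' L → All (BothEnds (Outside lo hi)) L
spans⇒outside {lo} {hi} {s'} {t'} {lo'} {hi'} s'<lo t'<lo disjoint = All.map (Product.map out out)
  where
  out : ∀ {x} → InRange s' t' lo' hi' x → Outside lo hi x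
  out (inj₁ refl)                 = inj₁ s'<lo
  out (inj₂ (inj₁ refl))          = inj₁ t'<lo
  out (inj₂ (inj₂ (lo'≤x , x<hi'))) =
    Sum.map (ℕP.<-≤-trans x<hi') (λ hi≤lo' → ℕP.≤-trans hi≤lo' lo'≤x) disjoint

data Pendants (s t : ℕ) (L : Edges) : ℕ → ℕ → ℕ → Set where
  []   : ∀ {lo hi} → Pendants s t L lo hi 0
  cons : ∀ {lo hi m} a → lo ≤ a → a < hi → Pendant s t L a → Pendants s t L (suc a) hi m →
         Pendants s t L lo hi (suc m)

module _ {s t : ℕ} {L : Edges} where

  vertex : ∀ {lo hi m} → Pendants s t L lo hi m → Fin m → ℕ
  vertex (cons a _ _ _ _)  zero    = a
  vertex (cons _ _ _ _ ps) (suc i) = vertex ps i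

  vertex-pendant : ∀ {lo hi m} (ps : Pendants s t L lo hi m) i → Pendant s t L (vertex ps i)
  vertex-pendant (cons _ _ _ p _)  zero    = p
  vertex-pendant (cons _ _ _ _ ps) (suc i) = vertex-pendant ps i

  lo≤vertex : ∀ {lo hi m} (ps : Pendants s t L lo hi m) i → lo ≤ vertex ps i
  lo≤vertex (cons _ lo≤a _ _ _)  zero    = lo≤a
  lo≤vertex (cons _ lo≤a _ _ ps) (suc i) = ℕP.≤-trans lo≤a (ℕP.<⇒≤ (lo≤vertex ps i))

  vertex-injective : ∀ {lo hi m} (ps : Pendants s t L lo hi m) → Injective _≡_ _≡_ (vertex ps)
  vertex-injective (cons _ _ _ _ _)  {zero}  {zero}  _  = refl
  vertex-injective (cons _ _ _ _ ps) {zero}  {suc j} eq = ⊥-elim (ℕP.<-irrefl eq (lo≤vertex ps j))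
  vertex-injective (cons _ _ _ _ ps) {suc i} {zero}  eq = ⊥-elim (ℕP.<-irrefl (sym eq) (lo≤vertex ps i))
  vertex-injective (cons _ _ _ _ ps) {suc i} {suc j} eq = cong suc (vertex-injective ps eq)

pendants-map : ∀ {s t L L' lo hi m} → (∀ {a} → lo ≤ a → a < hi → Pendant s t L a → Pendant s t L' a) →
               Pendants s t L lo hi m → Pendants s t L' lo hi m
pendants-map f []                      = []
pendants-map f (cons a lo≤a a<hi p ps) =
  cons a lo≤a a<hi (f lo≤a a<hi p) (pendants-map (λ a<b → f (ℕP.≤-trans lo≤a (ℕP.<⇒≤ a<b))) ps)

pendants-widen : ∀ {s t L lo hi lo' hi' m} → lo' ≤ lo → hi ≤ hi' → Pendants s t L lo hi m → Pendants s t L lo' hi' m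
pendants-widen lo'≤lo hi≤hi' []                      = []
pendants-widen lo'≤lo hi≤hi' (cons a lo≤a a<hi p ps) =
  cons a (ℕP.≤-trans lo'≤lo lo≤a) (ℕP.<-≤-trans a<hi hi≤hi') p (pendants-widen ℕP.≤-refl hi≤hi' ps)

module _ {s t lo hi m s' t' lo' hi' : ℕ} {L L' : Edges} (L'-spans : Spans s' t' lo' hi' L')
         (s'<lo : s' < lo) (t'<lo : t' < lo) where

  pendants-prepend : hi' ≤ lo → Pendants s t L lo hi m → Pendants s t (L' ++ L) lo hi m
  pendants-prepend hi'≤lo = pendants-map λ lo≤a a<hi →
    pendant-++ˡ (All.map (outside⇒confined lo≤a a<hi) (spans⇒outside s'<lo t'<lo (inj₁ hi'≤lo) L'-spans))

  pendants-append : hi ≤ lo' → Pendants s t L lo hi m → Pendants s t (L ++ L') lo hi m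
  pendants-append hi≤lo' = pendants-map λ lo≤a a<hi →
    pendant-++ʳ (All.map (outside⇒confined lo≤a a<hi) (spans⇒outside s'<lo t'<lo (inj₂ hi≤lo') L'-spans))

R₄ : Edges → ℕ → ℕ → Set
R₄ L lo hi = ∃₂ λ s t → Pendants s t L lo hi 4

mapR₄ : ∀ {L L' lo hi lo' hi'} → (∀ {s t} → Pendants s t L lo hi 4 → Pendants s t L' lo' hi' 4) →
        R₄ L lo hi → R₄ L' lo' hi'
mapR₄ f (s , t , ps) = s , t , f ps

HasR₄ : ℕ → Edges × ℕ → Set
HasR₄ k (L , k') = R₄ L k k'

P₂-children⇒pendants : ∀ {m cs} → replicate m P₂ ⊑ cs → ∀ {s t k} → s < k → t < k →
         Pendants s t (proj₁ (buildPar cs s t k)) k (proj₂ (buildPar cs s t k)) m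
P₂-children⇒pendants {zero}              _            _   _   = []
P₂-children⇒pendants {suc m} {c ∷ cs}    (.c ∷ʳ sub) {s} {t} {k} s<k t<k with build-spanned c s t k
... | k≤k₁ , L₁ = pendants-widen k≤k₁ ℕP.≤-refl
  (pendants-prepend L₁ (ℕP.<-≤-trans s<k k≤k₁) (ℕP.<-≤-trans t<k k≤k₁) ℕP.≤-refl
    (P₂-children⇒pendants sub (ℕP.<-≤-trans s<k k≤k₁) (ℕP.<-≤-trans t<k k≤k₁)))
P₂-children⇒pendants {suc m} {.P₂ ∷ cs} (refl ∷ sub) {s} {t} {k} s<k t<k with buildPar-spanned cs s t (suc k)
... | 1+k≤k' , L' =
  cons k ℕP.≤-refl 1+k≤k' (pendant-++ʳ (All.map (outside⇒confined ℕP.≤-refl ℕP.≤-refl)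
                                          (spans⇒outside s<k t<k (inj₂ ℕP.≤-refl) L'))
                                        (P₂-pendant s<k t<k))
    (pendants-prepend (proj₂ (build-spanned P₂ s t k)) (ℕP.m<n⇒m<1+n s<k) (ℕP.m<n⇒m<1+n t<k) ℕP.≤-refl
      (P₂-children⇒pendants sub (ℕP.m<n⇒m<1+n s<k) (ℕP.m<n⇒m<1+n t<k)))

mutual
  build-hasR₄ : ∀ {T} → ContainsR4 T → ∀ {s t k} → s < k → t < k → HasR₄ k (build T s t k)
  build-hasR₄ (here sub)  s<k t<k = -, -, P₂-children⇒pendants sub s<k t<k
  build-hasR₄ (inSer any) s<k t<k = buildSer-hasR₄ any s<k t<k
  build-hasR₄ (inPar any) s<k t<k = buildPar-hasR₄ any s<k t<k

  buildSer-hasR₄ : ∀ {cs} → Any ContainsR4 cs → ∀ {s t k} → s < k → t < k → HasR₄ k (buildSer cs s t k)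
  buildSer-hasR₄ {c ∷ []}     (here r₄)  s<k t<k = build-hasR₄ r₄ s<k t<k
  buildSer-hasR₄ {c ∷ d ∷ cs} (here r₄)  {s} {t} {k} s<k t<k
    with build-spanned c s k (suc k) | buildSer-spanned (d ∷ cs) k t (proj₂ (build c s k (suc k)))
  ... | _ , _ | k₁≤k₂ , L₂ =
    mapR₄ (pendants-widen (ℕP.n≤1+n k) k₁≤k₂ ∘ pendants-append L₂ (ℕP.n<1+n k) (ℕP.m<n⇒m<1+n t<k) ℕP.≤-refl)
      (build-hasR₄ r₄ (ℕP.m<n⇒m<1+n s<k) (ℕP.n<1+n k))
  buildSer-hasR₄ {c ∷ d ∷ cs} (there any) {s} {t} {k} s<k t<k with build-spanned c s k (suc k)
  ... | k<k₁ , L₁ =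
    mapR₄ (pendants-widen (ℕP.<⇒≤ k<k₁) ℕP.≤-refl ∘ pendants-prepend L₁ (ℕP.<-trans s<k k<k₁) k<k₁ ℕP.≤-refl)
      (buildSer-hasR₄ any k<k₁ (ℕP.<-trans t<k k<k₁))

  buildPar-hasR₄ : ∀ {cs} → Any ContainsR4 cs → ∀ {s t k} → s < k → t < k → HasR₄ k (buildPar cs s t k)
  buildPar-hasR₄ {c ∷ cs} (here r₄) {s} {t} {k} s<k t<k
    with build-spanned c s t k | buildPar-spanned cs s t (proj₂ (build c s t k))
  ... | _ , _ | k₁≤k₂ , L₂ =
    mapR₄ (pendants-widen ℕP.≤-refl k₁≤k₂ ∘ pendants-append L₂ s<k t<k ℕP.≤-refl) (build-hasR₄ r₄ s<k t<k)
  buildPar-hasR₄ {c ∷ cs} (there any) {s} {t} {k} s<k t<k with build-spanned c s t k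
  ... | k≤k₁ , L₁ =
    mapR₄ (pendants-widen k≤k₁ ℕP.≤-refl ∘ pendants-prepend L₁ (ℕP.<-≤-trans s<k k≤k₁) (ℕP.<-≤-trans t<k k≤k₁) ℕP.≤-refl)
      (buildPar-hasR₄ any (ℕP.<-≤-trans s<k k≤k₁) (ℕP.<-≤-trans t<k k≤k₁))

module _ {G : Graph} (labels< : All (BothEnds (_< n G)) (E G)) where

  private
    fromℕ<-edge : ∀ {x y} (x<n : x < n G) (y<n : y < n G) → (x , y) ∈ₗ E G → Edge G (fromℕ< x<n) (fromℕ< y<n)
    fromℕ<-edge x<n y<n = subst₂ (λ x y → (x , y) ∈ₗ E G) (sym (FinP.toℕ-fromℕ< x<n)) (sym (FinP.toℕ-fromℕ< y<n))

    fromℕ<-≢ : ∀ {x y} (x<n : x < n G) (y<n : y < n G) → x ≢ y → fromℕ< x<n ≢ fromℕ< y<n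
    fromℕ<-≢ x<n y<n x≢y = x≢y ∘ FinP.fromℕ<-injective _ _ x<n y<n

    ≡fromℕ< : ∀ {x} {w : Fin (n G)} (x<n : x < n G) → toℕ w ≡ x → w ≡ fromℕ< x<n
    ≡fromℕ< x<n w≡x = FinP.toℕ-injective (trans w≡x (sym (FinP.toℕ-fromℕ< x<n)))

  pendants⇒parallelP₂s : ∀ {s t lo hi k} → Pendants s t (E G) lo hi (suc k) → ParallelP₂s G (suc k)
  pendants⇒parallelP₂s {s} {t} {k = k} ps = record
    { s              = fromℕ< s<n
    ; t              = fromℕ< t<n
    ; mid            = mid
    ; mid-injective  = vertex-injective ps ∘ FinP.fromℕ<-injective _ _ (a<n _) (a<n _)
    ; mid≢s          = λ i → fromℕ<-≢ (a<n i) s<n (a≢s i)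
    ; mid≢t          = λ i → fromℕ<-≢ (a<n i) t<n (a≢t i)
    ; s—mid          = λ i → fromℕ<-edge s<n (a<n i) (s—a i)
    ; mid—t          = λ i → fromℕ<-edge (a<n i) t<n (a—t i)
    ; mid-neighbours = neighbours
    }
    where
    open module Pᵢ i = Pendant (vertex-pendant ps i)
    a<n : ∀ i → vertex ps i < n G
    a<n i = proj₂ (All.lookup labels< (s—a i))
    s<n : s < n G
    s<n = proj₁ (All.lookup labels< (s—a zero))
    t<n : t < n G
    t<n = proj₂ (All.lookup labels< (a—t zero))
    mid : Fin (suc k) → Fin (n G)
    mid i = fromℕ< (a<n i)
    terminal : ∀ {w} → toℕ w ≡ s ⊎ toℕ w ≡ t → w ≡ fromℕ< s<n ⊎ w ≡ fromℕ< t<n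
    terminal = Sum.map (≡fromℕ< s<n) (≡fromℕ< t<n)
    neighbours : ∀ i {w} → Linked G (mid i) w → w ≡ fromℕ< s<n ⊎ w ≡ fromℕ< t<n
    neighbours i (inj₁ mᵢw) = terminal (proj₁ (All.lookup (confined i) mᵢw) (FinP.toℕ-fromℕ< (a<n i)))
    neighbours i (inj₂ wmᵢ) = terminal (proj₂ (All.lookup (confined i) wmᵢ) (FinP.toℕ-fromℕ< (a<n i)))

spGraph-labels< : ∀ T → All (BothEnds (_< n (spGraph T))) (E (spGraph T))
spGraph-labels< T with build-spanned T 0 1 2
... | 2≤n , spans = All.map (Product.map label< label<) spans
  where
  label< : ∀ {x} → InRange 0 1 2 (n (spGraph T)) x → x < n (spGraph T)
  label< (inj₁ refl)               = ℕP.<-≤-trans (s≤s z≤n) 2≤n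
  label< (inj₂ (inj₁ refl))        = 2≤n
  label< (inj₂ (inj₂ (_ , x<n)))   = x<n

containsR4⇒parallelP₂s : ∀ T → ContainsR4 T → ParallelP₂s (spGraph T) 4
containsR4⇒parallelP₂s T r₄ with build-hasR₄ r₄ {0} {1} {2} (s≤s z≤n) (s≤s (s≤s z≤n))
... | _ , _ , ps = pendants⇒parallelP₂s (spGraph-labels< T) ps

lemma4p6 : (T : Node) → WF T → ContainsR4 T → ¬ MinimallyTough (spGraph T) ½
lemma4p6 T _ r₄ = parallelP₂s⇒¬minimallyTough (containsR4⇒parallelP₂s T r₄)
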